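{- Let $k,n\geq 3$ be integers. Then $I(C_k,x)$ divides $I(C_n,x)$ (in $\mathbb{Q}[x]$) if and only if $n/k$ is an odd integer.
   Context: For a simple graph $G$, the independence polynomial is $I(G,x)=\sum_{j\geq 0} i_j(G)x^j$, where $i_j(G)$ is the number of independent vertex sets of size $j$. $C_n$ denotes the cycle on $n$ vertices. -}

module Defs where

open import Data.Bool using (Bool; true; false; _∧_; _∨_; not)
open import Data.Nat using (ℕ; zero; suc; _+_; _*_; _%_; _≡ᵇ_)
open import Data.Fin using (Fin; toℕ)
open import Data.Fin.Subset using (Subset; ∣_∣)
open import Data.Vec using (Vec; []; _∷_; lookup)
open import Data.List using (List; []; _∷_; map; _++_; allFin; upTo)
open import Data.Integer using (+_)
open import Data.Rational using (ℚ; 0ℚ; _/_) renaming (_+_ to _+ℚ_; _*_ to _*ℚ_)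
open import Data.Product using (Σ; _,_)
open import Relation.Binary.PropositionalEquality using (_≡_)
open import Relation.Nullary.Decidable using (does)
open import Data.Nat.Properties using (_≟_)

-- Simple graphs on vertex set Fin n, given by a Boolean adjacency
-- relation (symmetric and irreflexive for the graphs we use).

record Graph (n : ℕ) : Set where
  field
    adj : Fin n → Fin n → Bool

open Graph public

-- The cycle C_n on vertices 0,…,n-1: i ~ j iff j ≡ i+1 (mod n) or i ≡ j+1 (mod n).
-- (For n ≥ 3 this is the simple cycle graph.)
cycleAdj : (n : ℕ) → Fin n → Fin n → Bool
cycleAdj zero    i j = false
cycleAdj (suc m) i j =
  (toℕ j ≡ᵇ ((toℕ i + 1) % suc m)) ∨ (toℕ i ≡ᵇ ((toℕ j + 1) % suc m))

C : (n : ℕ) → Graph n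
C n = record { adj = cycleAdj n }

allSubsets : (n : ℕ) → List (Subset n)
allSubsets zero    = [] ∷ []
allSubsets (suc n) = map (true ∷_) (allSubsets n) ++ map (false ∷_) (allSubsets n)

allᵇ : {A : Set} → (A → Bool) → List A → Bool
allᵇ p []       = true
allᵇ p (x ∷ xs) = p x ∧ allᵇ p xs

countᵇ : {A : Set} → (A → Bool) → List A → ℕ
countᵇ p []       = 0
countᵇ p (x ∷ xs) with p x
... | true  = suc (countᵇ p xs)
... | false = countᵇ p xs

isIndependent : ∀ {n} → Graph n → Subset n → Bool
isIndependent {n} G S =
  allᵇ (λ i → allᵇ (λ j → not (adj G i j ∧ lookup S i ∧ lookup S j)) (allFin n)) (allFin n)

indepCount : ∀ {n} → Graph n → ℕ → ℕ
indepCount {n} G j =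
  countᵇ (λ S → isIndependent G S ∧ (∣ S ∣ ≡ᵇ j)) (allSubsets n)

-- Polynomials over ℚ as coefficient lists (constant term first).

Poly : Set
Poly = List ℚ

coeff : Poly → ℕ → ℚ
coeff []       _       = 0ℚ
coeff (a ∷ p)  zero    = a
coeff (a ∷ p)  (suc i) = coeff p i

_+ₚ_ : Poly → Poly → Poly
[]      +ₚ q       = q
(a ∷ p) +ₚ []      = a ∷ p
(a ∷ p) +ₚ (b ∷ q) = (a +ℚ b) ∷ (p +ₚ q)

_*ₚ_ : Poly → Poly → Poly
[]      *ₚ q = []
(a ∷ p) *ₚ q = map (a *ℚ_) q +ₚ (0ℚ ∷ (p *ₚ q))

_≈ₚ_ : Poly → Poly → Set
p ≈ₚ q = ∀ i → coeff p i ≡ coeff q i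

_∣ₚ_ : Poly → Poly → Set
d ∣ₚ p = Σ Poly (λ q → p ≈ₚ (d *ₚ q))

I : ∀ {n} → Graph n → Poly
I {n} G = map (λ j → (+ indepCount G j) / 1) (upTo (suc n))

module Submission where

-- I(C_n, x) is the Lucas polynomial L_n (L_0 = 2, L_1 = 1, L_{n+2} = L_{n+1} + x L_n): according
-- to whether vertex 0 is used, the independent sets of C_n are those of paths on n - 3 and on
-- n - 1 vertices, and path counts satisfy the Fibonacci recurrence.
-- The identity L_k L_{k+n} = L_{2k+n} + (-x)^k L_n, with L_k(0) = 1 prime to x, gives
-- L_k ∣ L_n ⇔ L_k ∣ L_{2k+n}, so n may be reduced modulo 2k. For r < k the degrees
-- ⌊r/2⌋ ≤ ⌊k/2⌋ force a constant quotient, which the coefficients of 1 and x rule out; for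
-- k < r < 2k the identity for (r - k, 2k - r) reduces L_k ∣ L_r to L_k ∣ L_{2k-r}. Hence
-- L_k ∣ L_n exactly when n ≡ k modulo 2k.

open import Algebra.Bundles using (CommutativeRing)

module RingDivisibility {c ℓ} (R : CommutativeRing c ℓ) where

  open CommutativeRing R
  open import Algebra.Properties.Ring ring using (-‿distribˡ-*)
  open import Algebra.Properties.Semiring.Divisibility semiring using (_∣_; _,_; ∣ʳ-respʳ-≈)
  open import Relation.Binary.Reasoning.Setoid setoid

  ∣-+ : ∀ {d a b} → d ∣ a → d ∣ b → d ∣ a + b
  ∣-+ {d} (q , qd≈a) (r , rd≈b) = q + r , trans (distribʳ d q r) (+-cong qd≈a rd≈b)

  ∣-neg : ∀ {d a} → d ∣ a → d ∣ - a
  ∣-neg {d} (q , qd≈a) = - q , trans (sym (-‿distribˡ-* q d)) (-‿cong qd≈a)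

  ∣-cancelˡ-+ : ∀ {d a b} → d ∣ a + b → d ∣ a → d ∣ b
  ∣-cancelˡ-+ {d} {a} {b} d∣a+b d∣a = ∣ʳ-respʳ-≈ a+b-a≈b (∣-+ d∣a+b (∣-neg d∣a))
    where
    a+b-a≈b : (a + b) + - a ≈ b
    a+b-a≈b = begin
      (a + b) + - a  ≈⟨ +-congʳ (+-comm a b) ⟩
      (b + a) + - a  ≈⟨ +-assoc b a (- a) ⟩
      b + (a + - a)  ≈⟨ +-congˡ (-‿inverseʳ a) ⟩
      b + 0#         ≈⟨ +-identityʳ b ⟩
      b              ∎

  ∣-cancelʳ-+ : ∀ {d a b} → d ∣ a + b → d ∣ b → d ∣ a
  ∣-cancelʳ-+ {a = a} {b} d∣a+b = ∣-cancelˡ-+ (∣ʳ-respʳ-≈ (+-comm a b) d∣a+b)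

open import Defs

open import Algebra.Solver.Ring.AlmostCommutativeRing
  using (fromCommutativeRing; _-Raw-AlmostCommutative⟶_)
open import Algebra.Structures using (IsCommutativeRing)
open import Data.Bool using (Bool; true; false; _∧_; not; T)
open import Data.Bool.Properties using (T-∧; T-∨; T-≡; T-not-≡; ⇔→≡; ∧-comm; ∧-zeroʳ)
open import Data.Empty using (⊥-elim)
open import Data.Fin using (Fin; toℕ; fromℕ<)
import Data.Fin.Properties as Fin
open import Data.Fin.Subset using (Subset; ∣_∣)
import Data.Integer as ℤ
import Data.Integer.Properties as ℤ
open import Data.List using ([]; _∷_; _++_; map; length; drop; applyUpTo; upTo; allFin)
open import Data.List.Membership.Propositional using (_∈_)
open import Data.List.Membership.Propositional.Properties using (∈-allFin)
open import Data.List.Properties using (length-map; length-applyUpTo)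
open import Data.List.Relation.Unary.Any using (here; there)
open import Data.Maybe using (Maybe; just; nothing)
open import Data.Nat as ℕ using (ℕ; zero; suc; _≤_; _<_; _+_; _*_; _≡ᵇ_; z≤n; s≤s; ⌊_/2⌋)
open import Data.Nat.Coprimality as Coprime using (1-coprimeTo)
open import Data.Nat.DivMod using (_/_; _%_; m≡m%n+[m/n]*n; m%n<n; m<n⇒m%n≡m; n%n≡0)
import Data.Nat.Properties as ℕ
open import Algebra.Properties.CommutativeSemigroup ℕ.+-commutativeSemigroup using (interchange)
open import Data.Nat.Tactic.RingSolver using (solve-∀)
open import Data.Product using (∃; _,_; _×_; proj₁; proj₂)
open import Data.Rational as ℚ using (ℚ; 0ℚ; 1ℚ; mkℚ; 1/_; ≢-nonZero)
import Data.Rational.Properties as ℚ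
open import Data.Rational.Solver using (module +-*-Solver)
open import Data.Sum as Sum using (_⊎_; inj₁; inj₂)
open import Data.Unit using (tt)
open import Data.Vec using (Vec; []; _∷_; lookup)
open import Function.Bundles using (_⇔_; mk⇔; Equivalence)
open import Function.Construct.Composition using (_⇔-∘_)
open import Function.Construct.Symmetry using (⇔-sym)
import Relation.Binary.Reasoning.Setoid
open import Relation.Binary.PropositionalEquality
  using (_≡_; _≢_; refl; sym; trans; cong; cong₂; subst; subst₂; module ≡-Reasoning)
open import Relation.Nullary using (¬_; yes; no)

fromℕ : ℕ → ℚ
fromℕ n = ℤ.+ n ℚ./ 1

fromℕ≡mkℚ : ∀ n → fromℕ n ≡ mkℚ (ℤ.+ n) 0 (Coprime.sym (1-coprimeTo n))
fromℕ≡mkℚ n = ℚ.normalize-coprime (Coprime.sym (1-coprimeTo n))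

fromℕ-+ : ∀ m n → fromℕ m ℚ.+ fromℕ n ≡ fromℕ (m + n)
fromℕ-+ m n rewrite fromℕ≡mkℚ m | fromℕ≡mkℚ n =
  cong₂ (λ a b → (a ℤ.+ b) ℚ./ 1) (ℤ.*-identityʳ (ℤ.+ m)) (ℤ.*-identityʳ (ℤ.+ n))

fromℕ-* : ∀ m n → fromℕ m ℚ.* fromℕ n ≡ fromℕ (m * n)
fromℕ-* m n rewrite fromℕ≡mkℚ m | fromℕ≡mkℚ n = cong (ℚ._/ 1) (sym (ℤ.pos-* m n))

fromℕ-injective : ∀ {m n} → fromℕ m ≡ fromℕ n → m ≡ n
fromℕ-injective {m} {n} eq with trans (sym (fromℕ≡mkℚ m)) (trans eq (fromℕ≡mkℚ n))
... | refl = refl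

p≢0∧p*q≡0⇒q≡0 : ∀ {p q} → p ≢ 0ℚ → p ℚ.* q ≡ 0ℚ → q ≡ 0ℚ
p≢0∧p*q≡0⇒q≡0 {p} {q} p≢0 pq≡0 = begin
  q                    ≡⟨ sym (ℚ.*-identityˡ q) ⟩
  1ℚ ℚ.* q             ≡⟨ cong (ℚ._* q) (sym (ℚ.*-inverseˡ p)) ⟩
  (1/ p ℚ.* p) ℚ.* q   ≡⟨ ℚ.*-assoc (1/ p) p q ⟩
  1/ p ℚ.* (p ℚ.* q)   ≡⟨ cong (1/ p ℚ.*_) pq≡0 ⟩
  1/ p ℚ.* 0ℚ          ≡⟨ ℚ.*-zeroʳ (1/ p) ⟩
  0ℚ                   ∎
  where
  open ≡-Reasoning
  instance _ = ≢-nonZero p≢0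

-- The polynomial ring ℚ[x]

scale : ℚ → Poly → Poly
scale a = map (a ℚ.*_)

negₚ : Poly → Poly
negₚ = map (λ a → ℚ.- a)

X : Poly
X = 0ℚ ∷ 1ℚ ∷ []

coeff-+ₚ : ∀ p q i → coeff (p +ₚ q) i ≡ coeff p i ℚ.+ coeff q i
coeff-+ₚ []      q       i       = sym (ℚ.+-identityˡ (coeff q i))
coeff-+ₚ (a ∷ p) []      i       = sym (ℚ.+-identityʳ (coeff (a ∷ p) i))
coeff-+ₚ (a ∷ p) (b ∷ q) zero    = refl
coeff-+ₚ (a ∷ p) (b ∷ q) (suc i) = coeff-+ₚ p q i

coeff-scale : ∀ a q i → coeff (scale a q) i ≡ a ℚ.* coeff q i
coeff-scale a []      i       = sym (ℚ.*-zeroʳ a)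
coeff-scale a (b ∷ q) zero    = refl
coeff-scale a (b ∷ q) (suc i) = coeff-scale a q i

coeff-negₚ : ∀ q i → coeff (negₚ q) i ≡ ℚ.- coeff q i
coeff-negₚ []      i       = refl
coeff-negₚ (b ∷ q) zero    = refl
coeff-negₚ (b ∷ q) (suc i) = coeff-negₚ q i

coeff-*ₚ-zero : ∀ a p q → coeff ((a ∷ p) *ₚ q) zero ≡ a ℚ.* coeff q zero
coeff-*ₚ-zero a p q = trans (coeff-+ₚ (scale a q) (0ℚ ∷ (p *ₚ q)) zero)
                           (trans (ℚ.+-identityʳ _) (coeff-scale a q zero))

coeff-*ₚ-suc : ∀ a p q i →
  coeff ((a ∷ p) *ₚ q) (suc i) ≡ a ℚ.* coeff q (suc i) ℚ.+ coeff (p *ₚ q) i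
coeff-*ₚ-suc a p q i = trans (coeff-+ₚ (scale a q) (0ℚ ∷ (p *ₚ q)) (suc i))
                             (cong (ℚ._+ coeff (p *ₚ q) i) (coeff-scale a q (suc i)))

+ₚ-cong : ∀ {p p′ q q′} → p ≈ₚ p′ → q ≈ₚ q′ → (p +ₚ q) ≈ₚ (p′ +ₚ q′)
+ₚ-cong {p} {p′} {q} {q′} p≈p′ q≈q′ i =
  trans (coeff-+ₚ p q i) (trans (cong₂ ℚ._+_ (p≈p′ i) (q≈q′ i)) (sym (coeff-+ₚ p′ q′ i)))

+ₚ-assoc : ∀ p q r → ((p +ₚ q) +ₚ r) ≈ₚ (p +ₚ (q +ₚ r))
+ₚ-assoc p q r i = begin
  coeff ((p +ₚ q) +ₚ r) i                ≡⟨ coeff-+ₚ (p +ₚ q) r i ⟩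
  coeff (p +ₚ q) i ℚ.+ coeff r i         ≡⟨ cong (ℚ._+ coeff r i) (coeff-+ₚ p q i) ⟩
  (coeff p i ℚ.+ coeff q i) ℚ.+ coeff r i ≡⟨ ℚ.+-assoc (coeff p i) (coeff q i) (coeff r i) ⟩
  coeff p i ℚ.+ (coeff q i ℚ.+ coeff r i) ≡⟨ cong (coeff p i ℚ.+_) (sym (coeff-+ₚ q r i)) ⟩
  coeff p i ℚ.+ coeff (q +ₚ r) i         ≡⟨ sym (coeff-+ₚ p (q +ₚ r) i) ⟩
  coeff (p +ₚ (q +ₚ r)) i                ∎
  where open ≡-Reasoning

+ₚ-comm : ∀ p q → (p +ₚ q) ≈ₚ (q +ₚ p)
+ₚ-comm p q i =
  trans (coeff-+ₚ p q i) (trans (ℚ.+-comm (coeff p i) (coeff q i)) (sym (coeff-+ₚ q p i)))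

+ₚ-identityʳ : ∀ p → (p +ₚ []) ≈ₚ p
+ₚ-identityʳ p i = trans (coeff-+ₚ p [] i) (ℚ.+-identityʳ (coeff p i))

negₚ-cong : ∀ {p q} → p ≈ₚ q → negₚ p ≈ₚ negₚ q
negₚ-cong {p} {q} p≈q i = trans (coeff-negₚ p i) (trans (cong ℚ.-_ (p≈q i)) (sym (coeff-negₚ q i)))

negₚ-inverseˡ : ∀ p → (negₚ p +ₚ p) ≈ₚ []
negₚ-inverseˡ p i = trans (coeff-+ₚ (negₚ p) p i)
  (trans (cong (ℚ._+ coeff p i) (coeff-negₚ p i)) (ℚ.+-inverseˡ (coeff p i)))

*ₚ-congʳ : ∀ p {q q′} → q ≈ₚ q′ → (p *ₚ q) ≈ₚ (p *ₚ q′)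
*ₚ-congʳ []      q≈q′ i = refl
*ₚ-congʳ (a ∷ p) {q} {q′} q≈q′ zero = trans (coeff-*ₚ-zero a p q)
  (trans (cong (a ℚ.*_) (q≈q′ zero)) (sym (coeff-*ₚ-zero a p q′)))
*ₚ-congʳ (a ∷ p) {q} {q′} q≈q′ (suc i) = trans (coeff-*ₚ-suc a p q i)
  (trans (cong₂ ℚ._+_ (cong (a ℚ.*_) (q≈q′ (suc i))) (*ₚ-congʳ p q≈q′ i))
         (sym (coeff-*ₚ-suc a p q′ i)))

*ₚ-zeroˡ : ∀ p q → p ≈ₚ [] → (p *ₚ q) ≈ₚ []
*ₚ-zeroˡ []      q p≈0 i       = refl
*ₚ-zeroˡ (a ∷ p) q p≈0 zero    = trans (coeff-*ₚ-zero a p q)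
  (trans (cong (ℚ._* coeff q zero) (p≈0 zero)) (ℚ.*-zeroˡ (coeff q zero)))
*ₚ-zeroˡ (a ∷ p) q p≈0 (suc i) = trans (coeff-*ₚ-suc a p q i)
  (trans (cong₂ ℚ._+_ (trans (cong (ℚ._* coeff q (suc i)) (p≈0 zero)) (ℚ.*-zeroˡ (coeff q (suc i))))
                      (*ₚ-zeroˡ p q (λ j → p≈0 (suc j)) i))
         (ℚ.+-identityˡ 0ℚ))

*ₚ-congˡ : ∀ {p p′} q → p ≈ₚ p′ → (p *ₚ q) ≈ₚ (p′ *ₚ q)
*ₚ-congˡ {[]}    {[]}     q p≈p′ i = refl
*ₚ-congˡ {[]}    {b ∷ p′} q p≈p′ i = sym (*ₚ-zeroˡ (b ∷ p′) q (λ j → sym (p≈p′ j)) i)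
*ₚ-congˡ {a ∷ p} {[]}     q p≈p′   = *ₚ-zeroˡ (a ∷ p) q p≈p′
*ₚ-congˡ {a ∷ p} {b ∷ p′} q p≈p′ zero = trans (coeff-*ₚ-zero a p q)
  (trans (cong (ℚ._* coeff q zero) (p≈p′ zero)) (sym (coeff-*ₚ-zero b p′ q)))
*ₚ-congˡ {a ∷ p} {b ∷ p′} q p≈p′ (suc i) = trans (coeff-*ₚ-suc a p q i)
  (trans (cong₂ ℚ._+_ (cong (ℚ._* coeff q (suc i)) (p≈p′ zero))
                      (*ₚ-congˡ {p} {p′} q (λ j → p≈p′ (suc j)) i))
         (sym (coeff-*ₚ-suc b p′ q i)))

*ₚ-zeroʳ : ∀ p → (p *ₚ []) ≈ₚ []
*ₚ-zeroʳ []      i       = refl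
*ₚ-zeroʳ (a ∷ p) zero    = trans (coeff-*ₚ-zero a p []) (ℚ.*-zeroʳ a)
*ₚ-zeroʳ (a ∷ p) (suc i) = trans (coeff-*ₚ-suc a p [] i)
  (trans (cong₂ ℚ._+_ (ℚ.*-zeroʳ a) (*ₚ-zeroʳ p i)) (ℚ.+-identityˡ 0ℚ))

*ₚ-distribʳ : ∀ r p q → ((p +ₚ q) *ₚ r) ≈ₚ ((p *ₚ r) +ₚ (q *ₚ r))
*ₚ-distribʳ r []      q       i = refl
*ₚ-distribʳ r (a ∷ p) []      i = sym (+ₚ-identityʳ ((a ∷ p) *ₚ r) i)
*ₚ-distribʳ r (a ∷ p) (b ∷ q) zero = begin
  coeff ((a ℚ.+ b ∷ (p +ₚ q)) *ₚ r) 0       ≡⟨ coeff-*ₚ-zero (a ℚ.+ b) (p +ₚ q) r ⟩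
  (a ℚ.+ b) ℚ.* coeff r 0                   ≡⟨ ℚ.*-distribʳ-+ (coeff r 0) a b ⟩
  a ℚ.* coeff r 0 ℚ.+ b ℚ.* coeff r 0       ≡⟨ cong₂ ℚ._+_ (sym (coeff-*ₚ-zero a p r))
                                                           (sym (coeff-*ₚ-zero b q r)) ⟩
  coeff ((a ∷ p) *ₚ r) 0 ℚ.+ coeff ((b ∷ q) *ₚ r) 0
                                            ≡⟨ sym (coeff-+ₚ ((a ∷ p) *ₚ r) ((b ∷ q) *ₚ r) 0) ⟩
  coeff (((a ∷ p) *ₚ r) +ₚ ((b ∷ q) *ₚ r)) 0 ∎
  where open ≡-Reasoning
*ₚ-distribʳ r (a ∷ p) (b ∷ q) (suc i) = begin
  coeff ((a ℚ.+ b ∷ (p +ₚ q)) *ₚ r) (suc i)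
    ≡⟨ coeff-*ₚ-suc (a ℚ.+ b) (p +ₚ q) r i ⟩
  (a ℚ.+ b) ℚ.* rᵢ ℚ.+ coeff ((p +ₚ q) *ₚ r) i
    ≡⟨ cong ((a ℚ.+ b) ℚ.* rᵢ ℚ.+_) (trans (*ₚ-distribʳ r p q i) (coeff-+ₚ (p *ₚ r) (q *ₚ r) i)) ⟩
  (a ℚ.+ b) ℚ.* rᵢ ℚ.+ (coeff (p *ₚ r) i ℚ.+ coeff (q *ₚ r) i)
    ≡⟨ shuffle rᵢ a b (coeff (p *ₚ r) i) (coeff (q *ₚ r) i) ⟩
  (a ℚ.* rᵢ ℚ.+ coeff (p *ₚ r) i) ℚ.+ (b ℚ.* rᵢ ℚ.+ coeff (q *ₚ r) i)
    ≡⟨ cong₂ ℚ._+_ (sym (coeff-*ₚ-suc a p r i)) (sym (coeff-*ₚ-suc b q r i)) ⟩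
  coeff ((a ∷ p) *ₚ r) (suc i) ℚ.+ coeff ((b ∷ q) *ₚ r) (suc i)
    ≡⟨ sym (coeff-+ₚ ((a ∷ p) *ₚ r) ((b ∷ q) *ₚ r) (suc i)) ⟩
  coeff (((a ∷ p) *ₚ r) +ₚ ((b ∷ q) *ₚ r)) (suc i) ∎
  where
  open ≡-Reasoning
  open +-*-Solver
  rᵢ = coeff r (suc i)
  shuffle : ∀ x a b u v → (a ℚ.+ b) ℚ.* x ℚ.+ (u ℚ.+ v) ≡ (a ℚ.* x ℚ.+ u) ℚ.+ (b ℚ.* x ℚ.+ v)
  shuffle = solve 5 (λ x a b u v → (a :+ b) :* x :+ (u :+ v) := (a :* x :+ u) :+ (b :* x :+ v)) refl

*ₚ-identityˡ : ∀ p → ((1ℚ ∷ []) *ₚ p) ≈ₚ p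
*ₚ-identityˡ p zero    = trans (coeff-*ₚ-zero 1ℚ [] p) (ℚ.*-identityˡ (coeff p zero))
*ₚ-identityˡ p (suc i) = trans (coeff-*ₚ-suc 1ℚ [] p i)
  (trans (ℚ.+-identityʳ _) (ℚ.*-identityˡ (coeff p (suc i))))

shift-*ₚ : ∀ s r → ((0ℚ ∷ s) *ₚ r) ≈ₚ (0ℚ ∷ (s *ₚ r))
shift-*ₚ s r zero    = trans (coeff-*ₚ-zero 0ℚ s r) (ℚ.*-zeroˡ (coeff r zero))
shift-*ₚ s r (suc i) = trans (coeff-*ₚ-suc 0ℚ s r i)
  (trans (cong (ℚ._+ coeff (s *ₚ r) i) (ℚ.*-zeroˡ (coeff r (suc i)))) (ℚ.+-identityˡ _))

scale-*ₚ : ∀ a q r → (scale a q *ₚ r) ≈ₚ scale a (q *ₚ r)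
scale-*ₚ a []      r i       = refl
scale-*ₚ a (b ∷ q) r zero    = begin
  coeff ((a ℚ.* b ∷ scale a q) *ₚ r) 0 ≡⟨ coeff-*ₚ-zero (a ℚ.* b) (scale a q) r ⟩
  (a ℚ.* b) ℚ.* coeff r 0        ≡⟨ ℚ.*-assoc a b (coeff r 0) ⟩
  a ℚ.* (b ℚ.* coeff r 0)        ≡⟨ cong (a ℚ.*_) (sym (coeff-*ₚ-zero b q r)) ⟩
  a ℚ.* coeff ((b ∷ q) *ₚ r) 0   ≡⟨ sym (coeff-scale a ((b ∷ q) *ₚ r) 0) ⟩
  coeff (scale a ((b ∷ q) *ₚ r)) 0 ∎
  where open ≡-Reasoning
scale-*ₚ a (b ∷ q) r (suc i) = begin
  coeff ((a ℚ.* b ∷ scale a q) *ₚ r) (suc i)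
    ≡⟨ coeff-*ₚ-suc (a ℚ.* b) (scale a q) r i ⟩
  (a ℚ.* b) ℚ.* rᵢ ℚ.+ coeff (scale a q *ₚ r) i
    ≡⟨ cong₂ ℚ._+_ (ℚ.*-assoc a b rᵢ) (trans (scale-*ₚ a q r i) (coeff-scale a (q *ₚ r) i)) ⟩
  a ℚ.* (b ℚ.* rᵢ) ℚ.+ a ℚ.* coeff (q *ₚ r) i
    ≡⟨ sym (ℚ.*-distribˡ-+ a (b ℚ.* rᵢ) (coeff (q *ₚ r) i)) ⟩
  a ℚ.* (b ℚ.* rᵢ ℚ.+ coeff (q *ₚ r) i)
    ≡⟨ cong (a ℚ.*_) (sym (coeff-*ₚ-suc b q r i)) ⟩
  a ℚ.* coeff ((b ∷ q) *ₚ r) (suc i)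
    ≡⟨ sym (coeff-scale a ((b ∷ q) *ₚ r) (suc i)) ⟩
  coeff (scale a ((b ∷ q) *ₚ r)) (suc i) ∎
  where
  open ≡-Reasoning
  rᵢ = coeff r (suc i)

*ₚ-assoc : ∀ p q r → ((p *ₚ q) *ₚ r) ≈ₚ (p *ₚ (q *ₚ r))
*ₚ-assoc []      q r i = refl
*ₚ-assoc (a ∷ p) q r =
  λ i → trans (*ₚ-distribʳ r (scale a q) (0ℚ ∷ (p *ₚ q)) i)
              (+ₚ-cong {scale a q *ₚ r} {scale a (q *ₚ r)} {(0ℚ ∷ (p *ₚ q)) *ₚ r}
                       (scale-*ₚ a q r) (λ j → trans (shift-*ₚ (p *ₚ q) r j) (tail-assoc j)) i)
  where
  tail-assoc : (0ℚ ∷ ((p *ₚ q) *ₚ r)) ≈ₚ (0ℚ ∷ (p *ₚ (q *ₚ r)))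
  tail-assoc zero    = refl
  tail-assoc (suc j) = *ₚ-assoc p q r j

*ₚ-consʳ : ∀ q a p → (q *ₚ (a ∷ p)) ≈ₚ (scale a q +ₚ (0ℚ ∷ (q *ₚ p)))
*ₚ-consʳ []      a p zero    = refl
*ₚ-consʳ []      a p (suc i) = refl
*ₚ-consʳ (b ∷ q) a p zero    = begin
  coeff ((b ∷ q) *ₚ (a ∷ p)) 0                         ≡⟨ coeff-*ₚ-zero b q (a ∷ p) ⟩
  b ℚ.* a                                              ≡⟨ ℚ.*-comm b a ⟩
  a ℚ.* b                                              ≡⟨ sym (ℚ.+-identityʳ _) ⟩
  a ℚ.* b ℚ.+ 0ℚ
    ≡⟨ sym (coeff-+ₚ (scale a (b ∷ q)) (0ℚ ∷ ((b ∷ q) *ₚ p)) 0) ⟩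
  coeff (scale a (b ∷ q) +ₚ (0ℚ ∷ ((b ∷ q) *ₚ p))) 0 ∎
  where open ≡-Reasoning
*ₚ-consʳ (b ∷ q) a p (suc i) = begin
  coeff ((b ∷ q) *ₚ (a ∷ p)) (suc i)
    ≡⟨ coeff-*ₚ-suc b q (a ∷ p) i ⟩
  b ℚ.* coeff p i ℚ.+ coeff (q *ₚ (a ∷ p)) i
    ≡⟨ cong (b ℚ.* coeff p i ℚ.+_) (trans (*ₚ-consʳ q a p i) (coeff-+ₚ (scale a q) xqp i)) ⟩
  b ℚ.* coeff p i ℚ.+ (coeff (scale a q) i ℚ.+ coeff xqp i)
    ≡⟨ cong (λ z → b ℚ.* coeff p i ℚ.+ (z ℚ.+ coeff xqp i)) (coeff-scale a q i) ⟩
  b ℚ.* coeff p i ℚ.+ (a ℚ.* coeff q i ℚ.+ coeff xqp i)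
    ≡⟨ swap (b ℚ.* coeff p i) (a ℚ.* coeff q i) (coeff xqp i) ⟩
  a ℚ.* coeff q i ℚ.+ (b ℚ.* coeff p i ℚ.+ coeff xqp i)
    ≡⟨ cong₂ ℚ._+_ (sym (coeff-scale a q i))
                   (sym (trans (coeff-+ₚ (scale b p) xqp i)
                               (cong (ℚ._+ coeff xqp i) (coeff-scale b p i)))) ⟩
  coeff (scale a q) i ℚ.+ coeff (0ℚ ∷ ((b ∷ q) *ₚ p)) (suc i)
    ≡⟨ sym (coeff-+ₚ (scale a (b ∷ q)) (0ℚ ∷ ((b ∷ q) *ₚ p)) (suc i)) ⟩
  coeff (scale a (b ∷ q) +ₚ (0ℚ ∷ ((b ∷ q) *ₚ p))) (suc i) ∎
  where
  open ≡-Reasoning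
  open +-*-Solver
  xqp = 0ℚ ∷ (q *ₚ p)
  swap : ∀ x y z → x ℚ.+ (y ℚ.+ z) ≡ y ℚ.+ (x ℚ.+ z)
  swap = solve 3 (λ x y z → x :+ (y :+ z) := y :+ (x :+ z)) refl

*ₚ-comm : ∀ p q → (p *ₚ q) ≈ₚ (q *ₚ p)
*ₚ-comm []      q i = sym (*ₚ-zeroʳ q i)
*ₚ-comm (a ∷ p) q i =
  trans (+ₚ-cong {scale a q} {scale a q} {0ℚ ∷ (p *ₚ q)} (λ _ → refl) tail-comm i)
        (sym (*ₚ-consʳ q a p i))
  where
  tail-comm : (0ℚ ∷ (p *ₚ q)) ≈ₚ (0ℚ ∷ (q *ₚ p))
  tail-comm zero    = refl
  tail-comm (suc j) = *ₚ-comm p q j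

-- _≈ₚ_ wrapped in a record: unlike the Π-type it unfolds to, the record is injective,
-- so the polynomials can be inferred from an equality proof.
infix 4 _≃_
record _≃_ (p q : Poly) : Set where
  constructor mk≃
  field coeff-≡ : p ≈ₚ q
open _≃_ public

ℚ[x]-isCommutativeRing : IsCommutativeRing _≃_ _+ₚ_ _*ₚ_ negₚ [] (1ℚ ∷ [])
ℚ[x]-isCommutativeRing = record
  { isRing = record
    { +-isAbelianGroup = record
      { isGroup = record
        { isMonoid = record
          { isSemigroup = record
            { isMagma = record
              { isEquivalence = record
                { refl  = mk≃ (λ i → refl)
                ; sym   = λ (mk≃ p≈q) → mk≃ (λ i → sym (p≈q i))
                ; trans = λ (mk≃ p≈q) (mk≃ q≈r) → mk≃ (λ i → trans (p≈q i) (q≈r i))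
                }
              ; ∙-cong = λ {p} {p′} {q} {q′} (mk≃ p≈p′) (mk≃ q≈q′) →
                  mk≃ (+ₚ-cong {p} {p′} {q} {q′} p≈p′ q≈q′)
              }
            ; assoc = λ p q r → mk≃ (+ₚ-assoc p q r)
            }
          ; identity = (λ p → mk≃ (λ i → refl)) , (λ p → mk≃ (+ₚ-identityʳ p))
          }
        ; inverse = (λ p → mk≃ (negₚ-inverseˡ p))
                  , (λ p → mk≃ (λ i → trans (+ₚ-comm p (negₚ p) i) (negₚ-inverseˡ p i)))
        ; ⁻¹-cong = λ {p} {q} (mk≃ p≈q) → mk≃ (negₚ-cong {p} {q} p≈q)
        }
      ; comm = λ p q → mk≃ (+ₚ-comm p q)
      }
    ; *-cong = λ {p} {p′} {q} {q′} (mk≃ p≈p′) (mk≃ q≈q′) →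
        mk≃ (λ i → trans (*ₚ-congˡ {p} {p′} q p≈p′ i) (*ₚ-congʳ p′ {q} {q′} q≈q′ i))
    ; *-assoc = λ p q r → mk≃ (*ₚ-assoc p q r)
    ; *-identity = (λ p → mk≃ (*ₚ-identityˡ p))
                 , (λ p → mk≃ (λ i → trans (*ₚ-comm p (1ℚ ∷ []) i) (*ₚ-identityˡ p i)))
    ; distrib = (λ p q r → mk≃ (λ i → trans (*ₚ-comm p (q +ₚ r) i) (trans (*ₚ-distribʳ p q r i)
                   (+ₚ-cong {q *ₚ p} {p *ₚ q} {r *ₚ p} {p *ₚ r} (*ₚ-comm q p) (*ₚ-comm r p) i))))
              , (λ r p q → mk≃ (*ₚ-distribʳ r p q))
    }
  ; *-comm = λ p q → mk≃ (*ₚ-comm p q)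
  }

ℚ[x] : CommutativeRing _ _
ℚ[x] = record { isCommutativeRing = ℚ[x]-isCommutativeRing }

module ℚ[x] = CommutativeRing ℚ[x]
module ≃-Reasoning = Relation.Binary.Reasoning.Setoid ℚ[x].setoid

constₚ-homomorphism :
  CommutativeRing.rawRing ℚ.+-*-commutativeRing -Raw-AlmostCommutative⟶ fromCommutativeRing ℚ[x]
constₚ-homomorphism = record
  { ⟦_⟧    = _∷ []
  ; +-homo = λ a b → mk≃ (λ i → refl)
  ; *-homo = λ a b → mk≃ (λ { zero → sym (ℚ.+-identityʳ (a ℚ.* b)) ; (suc i) → refl })
  ; -‿homo = λ a → mk≃ (λ i → refl)
  ; 0-homo = mk≃ (λ { zero → refl ; (suc i) → refl })
  ; 1-homo = mk≃ (λ i → refl)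
  }

constₚ-≟ : ∀ a b → Maybe ((a ∷ []) ≃ (b ∷ []))
constₚ-≟ a b with a ℚ.≟ b
... | yes refl = just ℚ[x].refl
... | no _     = nothing

open import Algebra.Solver.Ring
  (CommutativeRing.rawRing ℚ.+-*-commutativeRing) (fromCommutativeRing ℚ[x])
  constₚ-homomorphism constₚ-≟
  using (solve; _:+_; _:*_; :-_; _:-_; _:=_)

-- Lucas polynomials

negX^ : ℕ → Poly
negX^ zero    = 1ℚ ∷ []
negX^ (suc k) = negₚ X *ₚ negX^ k

Recurrent : (ℕ → Poly) → Set
Recurrent s = ∀ n → s (suc (suc n)) ≃ s (suc n) +ₚ (X *ₚ s n)

Fib : ℕ → Poly
Fib zero          = []
Fib (suc zero)    = 1ℚ ∷ []
Fib (suc (suc n)) = Fib (suc n) +ₚ (X *ₚ Fib n)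

Fib′ : ℕ → Poly
Fib′ zero          = 1ℚ ∷ []
Fib′ (suc zero)    = []
Fib′ (suc (suc n)) = Fib′ (suc n) +ₚ (X *ₚ Fib′ n)

Luc : ℕ → Poly
Luc zero          = (1ℚ ∷ []) +ₚ (1ℚ ∷ [])
Luc (suc zero)    = 1ℚ ∷ []
Luc (suc (suc n)) = Luc (suc n) +ₚ (X *ₚ Luc n)

Luc-recurrent : Recurrent Luc
Luc-recurrent n = ℚ[x].refl

recurrent-split : ∀ s → Recurrent s →
  ∀ m n → s (m + n) ≃ (Fib m *ₚ s (suc n)) +ₚ (Fib′ m *ₚ s n)
recurrent-split s rec zero n = ℚ[x].sym (ℚ[x].*-identityˡ (s n))
recurrent-split s rec (suc zero) n =
  ℚ[x].sym (ℚ[x].trans (ℚ[x].+-identityʳ _) (ℚ[x].*-identityˡ (s (suc n))))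
recurrent-split s rec (suc (suc m)) n = begin
  s (suc (suc (m + n)))                                ≈⟨ rec (m + n) ⟩
  s (suc (m + n)) +ₚ (X *ₚ s (m + n))
    ≈⟨ ℚ[x].+-cong (recurrent-split s rec (suc m) n) (ℚ[x].*-congˡ {X} (recurrent-split s rec m n)) ⟩
  ((F₁ *ₚ s₁) +ₚ (H₁ *ₚ s₀)) +ₚ (X *ₚ ((F₀ *ₚ s₁) +ₚ (H₀ *ₚ s₀)))
    ≈⟨ solve 7 (λ F₁ F₀ H₁ H₀ x s₁ s₀ →
                  (F₁ :* s₁ :+ H₁ :* s₀) :+ x :* (F₀ :* s₁ :+ H₀ :* s₀)
                  := (F₁ :+ x :* F₀) :* s₁ :+ (H₁ :+ x :* H₀) :* s₀)
             ℚ[x].refl F₁ F₀ H₁ H₀ X s₁ s₀ ⟩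
  ((F₁ +ₚ (X *ₚ F₀)) *ₚ s₁) +ₚ ((H₁ +ₚ (X *ₚ H₀)) *ₚ s₀) ∎
  where
  open ≃-Reasoning
  F₁ = Fib (suc m); F₀ = Fib m; H₁ = Fib′ (suc m); H₀ = Fib′ m
  s₁ = s (suc n); s₀ = s n

Fib-suc : ∀ k → Fib (suc k) ≃ Fib k +ₚ Fib′ k
Fib-suc zero          = ℚ[x].refl
Fib-suc (suc zero)    =
  ℚ[x].trans (ℚ[x].+-congˡ {1ℚ ∷ []} (ℚ[x].zeroʳ X)) (ℚ[x].sym (ℚ[x].+-identityʳ (1ℚ ∷ [])))
Fib-suc (suc (suc k)) = begin
  Fib (suc (suc k)) +ₚ (X *ₚ Fib (suc k))
    ≈⟨ ℚ[x].+-cong (Fib-suc (suc k)) (ℚ[x].*-congˡ {X} (Fib-suc k)) ⟩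
  (Fib (suc k) +ₚ Fib′ (suc k)) +ₚ (X *ₚ (Fib k +ₚ Fib′ k))
    ≈⟨ solve 5 (λ a b c d x → (a :+ c) :+ x :* (b :+ d) := (a :+ x :* b) :+ (c :+ x :* d))
             ℚ[x].refl (Fib (suc k)) (Fib k) (Fib′ (suc k)) (Fib′ k) X ⟩
  (Fib (suc k) +ₚ (X *ₚ Fib k)) +ₚ (Fib′ (suc k) +ₚ (X *ₚ Fib′ k)) ∎
  where open ≃-Reasoning

Fib′-suc : ∀ k → Fib′ (suc k) ≃ X *ₚ Fib k
Fib′-suc zero          = ℚ[x].sym (ℚ[x].zeroʳ X)
Fib′-suc (suc zero)    = ℚ[x].refl
Fib′-suc (suc (suc k)) = begin
  Fib′ (suc (suc k)) +ₚ (X *ₚ Fib′ (suc k))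
    ≈⟨ ℚ[x].+-cong (Fib′-suc (suc k)) (ℚ[x].*-congˡ {X} (Fib′-suc k)) ⟩
  (X *ₚ Fib (suc k)) +ₚ (X *ₚ (X *ₚ Fib k))
    ≈⟨ ℚ[x].sym (ℚ[x].distribˡ X (Fib (suc k)) (X *ₚ Fib k)) ⟩
  X *ₚ (Fib (suc k) +ₚ (X *ₚ Fib k)) ∎
  where open ≃-Reasoning

Luc≃Fib+2Fib′ : ∀ k → Luc k ≃ Fib k +ₚ (Fib′ k +ₚ Fib′ k)
Luc≃Fib+2Fib′ zero          = ℚ[x].refl
Luc≃Fib+2Fib′ (suc zero)    = ℚ[x].sym (ℚ[x].+-identityʳ _)
Luc≃Fib+2Fib′ (suc (suc k)) = begin
  Luc (suc k) +ₚ (X *ₚ Luc k)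
    ≈⟨ ℚ[x].+-cong (Luc≃Fib+2Fib′ (suc k)) (ℚ[x].*-congˡ {X} (Luc≃Fib+2Fib′ k)) ⟩
  (Fib (suc k) +ₚ (Fib′ (suc k) +ₚ Fib′ (suc k))) +ₚ (X *ₚ (Fib k +ₚ (Fib′ k +ₚ Fib′ k)))
    ≈⟨ solve 5 (λ a b c d x → (a :+ (c :+ c)) :+ x :* (b :+ (d :+ d))
                              := (a :+ x :* b) :+ ((c :+ x :* d) :+ (c :+ x :* d)))
             ℚ[x].refl (Fib (suc k)) (Fib k) (Fib′ (suc k)) (Fib′ k) X ⟩
  (Fib (suc k) +ₚ (X *ₚ Fib k)) +ₚ ((Fib′ (suc k) +ₚ (X *ₚ Fib′ k)) +ₚ (Fib′ (suc k) +ₚ (X *ₚ Fib′ k))) ∎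
  where open ≃-Reasoning

cassini : ∀ k → negX^ k ≃ (Fib′ k *ₚ Fib (suc k)) ℚ[x].- (X *ₚ (Fib k *ₚ Fib k))
cassini zero = begin
  1ℚ ∷ []                                   ≈⟨ ℚ[x].sym (ℚ[x].*-identityˡ _) ⟩
  (1ℚ ∷ []) *ₚ (1ℚ ∷ [])                    ≈⟨ ℚ[x].sym (ℚ[x].+-identityʳ _) ⟩
  ((1ℚ ∷ []) *ₚ (1ℚ ∷ [])) ℚ[x].- []        ≈⟨ ℚ[x].+-congˡ {(1ℚ ∷ []) *ₚ (1ℚ ∷ [])}
                                                  (ℚ[x].-‿cong (ℚ[x].sym (ℚ[x].zeroʳ X))) ⟩
  ((1ℚ ∷ []) *ₚ (1ℚ ∷ [])) ℚ[x].- (X *ₚ []) ∎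
  where open ≃-Reasoning
cassini (suc k) = begin
  (ℚ[x].- X) *ₚ negX^ k
    ≈⟨ ℚ[x].*-congˡ {negₚ X} (cassini k) ⟩
  (ℚ[x].- X) *ₚ ((H *ₚ Fib (suc k)) ℚ[x].- (X *ₚ (F *ₚ F)))
    ≈⟨ ℚ[x].*-congˡ {negₚ X} (ℚ[x].+-congʳ {negₚ (X *ₚ (F *ₚ F))} (ℚ[x].*-congˡ {H} (Fib-suc k))) ⟩
  (ℚ[x].- X) *ₚ ((H *ₚ (F +ₚ H)) ℚ[x].- (X *ₚ (F *ₚ F)))
    ≈⟨ solve 3 (λ x f h → (:- x) :* (h :* (f :+ h) :- x :* (f :* f))
                          := (x :* f) :* ((f :+ h) :+ x :* f) :- x :* ((f :+ h) :* (f :+ h)))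
             ℚ[x].refl X F H ⟩
  ((X *ₚ F) *ₚ ((F +ₚ H) +ₚ (X *ₚ F))) ℚ[x].- (X *ₚ ((F +ₚ H) *ₚ (F +ₚ H)))
    ≈⟨ ℚ[x].+-cong (ℚ[x].*-cong (ℚ[x].sym (Fib′-suc k)) (ℚ[x].+-congʳ {X *ₚ F} (ℚ[x].sym (Fib-suc k))))
                   (ℚ[x].-‿cong (ℚ[x].*-congˡ {X}
                      (ℚ[x].*-cong (ℚ[x].sym (Fib-suc k)) (ℚ[x].sym (Fib-suc k))))) ⟩
  (Fib′ (suc k) *ₚ Fib (suc (suc k))) ℚ[x].- (X *ₚ (Fib (suc k) *ₚ Fib (suc k))) ∎
  where
  open ≃-Reasoning
  F = Fib k; H = Fib′ k

Luc-identity : ∀ k n → Luc (k + k + n) +ₚ (negX^ k *ₚ Luc n) ≃ Luc k *ₚ Luc (k + n)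
Luc-identity k n = begin
  Luc (k + k + n) +ₚ (negX^ k *ₚ L₀)
    ≈⟨ ℚ[x].+-cong (recurrent-split Luc Luc-recurrent (k + k) n) (ℚ[x].*-congʳ {L₀} (cassini k)) ⟩
  ((Fib (k + k) *ₚ L₁) +ₚ (Fib′ (k + k) *ₚ L₀)) +ₚ (((H *ₚ Fib (suc k)) ℚ[x].- (X *ₚ (F *ₚ F))) *ₚ L₀)
    ≈⟨ ℚ[x].+-cong (ℚ[x].+-cong (ℚ[x].*-congʳ Fib-double) (ℚ[x].*-congʳ Fib′-double))
                   (ℚ[x].*-congʳ (ℚ[x].+-congʳ (ℚ[x].*-congˡ {H} (Fib-suc k)))) ⟩
  ((((F *ₚ (F +ₚ H)) +ₚ (H *ₚ F)) *ₚ L₁) +ₚ (((F *ₚ (X *ₚ F)) +ₚ (H *ₚ H)) *ₚ L₀))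
    +ₚ (((H *ₚ (F +ₚ H)) ℚ[x].- (X *ₚ (F *ₚ F))) *ₚ L₀)
    ≈⟨ solve 5 (λ f h x l₁ l₀ →
                  ((f :* (f :+ h) :+ h :* f) :* l₁ :+ (f :* (x :* f) :+ h :* h) :* l₀)
                    :+ (h :* (f :+ h) :- x :* (f :* f)) :* l₀
                  := (f :+ (h :+ h)) :* (f :* l₁ :+ h :* l₀))
             ℚ[x].refl F H X L₁ L₀ ⟩
  (F +ₚ (H +ₚ H)) *ₚ ((F *ₚ L₁) +ₚ (H *ₚ L₀))
    ≈⟨ ℚ[x].*-cong (ℚ[x].sym (Luc≃Fib+2Fib′ k)) (ℚ[x].sym (recurrent-split Luc Luc-recurrent k n)) ⟩
  Luc k *ₚ Luc (k + n) ∎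
  where
  open ≃-Reasoning
  F = Fib k; H = Fib′ k; L₁ = Luc (suc n); L₀ = Luc n
  Fib-double : Fib (k + k) ≃ (F *ₚ (F +ₚ H)) +ₚ (H *ₚ F)
  Fib-double = ℚ[x].trans (recurrent-split Fib (λ _ → ℚ[x].refl) k k)
                          (ℚ[x].+-congʳ (ℚ[x].*-congˡ {F} (Fib-suc k)))
  Fib′-double : Fib′ (k + k) ≃ (F *ₚ (X *ₚ F)) +ₚ (H *ₚ H)
  Fib′-double = ℚ[x].trans (recurrent-split Fib′ (λ _ → ℚ[x].refl) k k)
                           (ℚ[x].+-congʳ (ℚ[x].*-congˡ {F} (Fib′-suc k)))

X* : (ℕ → ℕ) → ℕ → ℕ
X* a zero    = 0
X* a (suc j) = a j

X*-cong : ∀ {a b} → (∀ j → a j ≡ b j) → ∀ j → X* a j ≡ X* b j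
X*-cong a≡b zero    = refl
X*-cong a≡b (suc j) = a≡b j

RecurrentCoeffs : (ℕ → ℕ → ℕ) → Set
RecurrentCoeffs a = ∀ n j → a (suc (suc n)) j ≡ a (suc n) j + X* (a n) j

recurrentCoeffs-unique : ∀ {a b} → RecurrentCoeffs a → RecurrentCoeffs b →
  (∀ j → a 0 j ≡ b 0 j) → (∀ j → a 1 j ≡ b 1 j) → ∀ n j → a n j ≡ b n j
recurrentCoeffs-unique ra rb a₀≡b₀ a₁≡b₁ zero          = a₀≡b₀
recurrentCoeffs-unique ra rb a₀≡b₀ a₁≡b₁ (suc zero)    = a₁≡b₁
recurrentCoeffs-unique {a} {b} ra rb a₀≡b₀ a₁≡b₁ (suc (suc n)) j = begin
  a (suc (suc n)) j            ≡⟨ ra n j ⟩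
  a (suc n) j + X* (a n) j     ≡⟨ cong₂ _+_ (a≡b (suc n) j) (X*-cong (a≡b n) j) ⟩
  b (suc n) j + X* (b n) j     ≡⟨ sym (rb n j) ⟩
  b (suc (suc n)) j            ∎
  where
  open ≡-Reasoning
  a≡b = recurrentCoeffs-unique ra rb a₀≡b₀ a₁≡b₁

X*-+ : ∀ a b j → X* (λ i → a i + b i) j ≡ X* a j + X* b j
X*-+ a b zero    = refl
X*-+ a b (suc j) = refl

recurrentCoeffs-+ : ∀ {a b} → RecurrentCoeffs a → RecurrentCoeffs b →
  RecurrentCoeffs (λ n j → a n j + b n j)
recurrentCoeffs-+ {a} {b} ra rb n j = begin
  a (suc (suc n)) j + b (suc (suc n)) j                    ≡⟨ cong₂ _+_ (ra n j) (rb n j) ⟩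
  (a (suc n) j + X* (a n) j) + (b (suc n) j + X* (b n) j)
    ≡⟨ interchange (a (suc n) j) (X* (a n) j) (b (suc n) j) (X* (b n) j) ⟩
  (a (suc n) j + b (suc n) j) + (X* (a n) j + X* (b n) j)  ≡⟨ cong (a (suc n) j + b (suc n) j +_)
                                                                    (sym (X*-+ (a n) (b n) j)) ⟩
  (a (suc n) j + b (suc n) j) + X* (λ i → a n i + b n i) j ∎
  where open ≡-Reasoning

recurrentCoeffs-X* : ∀ {a} → RecurrentCoeffs a → RecurrentCoeffs (λ n → X* (a n))
recurrentCoeffs-X* ra n zero    = refl
recurrentCoeffs-X* ra n (suc j) = ra n j

lucasCoeff : ℕ → ℕ → ℕ
lucasCoeff zero          zero    = 2
lucasCoeff zero          (suc j) = 0
lucasCoeff (suc zero)    zero    = 1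
lucasCoeff (suc zero)    (suc j) = 0
lucasCoeff (suc (suc n)) j       = lucasCoeff (suc n) j + X* (lucasCoeff n) j

lucasCoeff-recurrent : RecurrentCoeffs lucasCoeff
lucasCoeff-recurrent n j = refl

lucasCoeff-suc-zero : ∀ n → lucasCoeff (suc n) 0 ≡ 1
lucasCoeff-suc-zero zero    = refl
lucasCoeff-suc-zero (suc n) = trans (ℕ.+-identityʳ _) (lucasCoeff-suc-zero n)

lucasCoeff-zero-pos : ∀ n → 0 < lucasCoeff n 0
lucasCoeff-zero-pos zero    = s≤s z≤n
lucasCoeff-zero-pos (suc n) = ℕ.≤-reflexive (sym (lucasCoeff-suc-zero n))

lucasCoeff-one : ∀ n → lucasCoeff (suc (suc n)) 1 ≡ suc (suc n)
lucasCoeff-one zero    = refl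
lucasCoeff-one (suc n) =
  trans (cong₂ _+_ (lucasCoeff-one n) (lucasCoeff-suc-zero n)) (ℕ.+-comm (suc (suc n)) 1)

lucasCoeff-one-≤ : ∀ n → lucasCoeff n 1 ≤ n
lucasCoeff-one-≤ zero          = z≤n
lucasCoeff-one-≤ (suc zero)    = z≤n
lucasCoeff-one-≤ (suc (suc n)) = ℕ.≤-reflexive (lucasCoeff-one n)

lucasCoeff-vanish : ∀ n j → ⌊ n /2⌋ < j → lucasCoeff n j ≡ 0
lucasCoeff-vanish zero          (suc j) _ = refl
lucasCoeff-vanish (suc zero)    (suc j) _ = refl
lucasCoeff-vanish (suc (suc n)) (suc j) (s≤s ⌊n/2⌋<j) = cong₂ _+_
  (lucasCoeff-vanish (suc n) (suc j) (s≤s (ℕ.≤-trans (ℕ.⌊n/2⌋-mono (ℕ.n≤1+n (suc n))) ⌊n/2⌋<j)))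
  (lucasCoeff-vanish n j ⌊n/2⌋<j)

lucasCoeff-top-pos : ∀ n → 0 < lucasCoeff n ⌊ n /2⌋
lucasCoeff-top-pos zero          = s≤s z≤n
lucasCoeff-top-pos (suc zero)    = s≤s z≤n
lucasCoeff-top-pos (suc (suc n)) =
  ℕ.<-≤-trans (lucasCoeff-top-pos n) (ℕ.m≤n+m _ (lucasCoeff (suc n) (suc ⌊ n /2⌋)))

fromℕ≢0 : ∀ {n} → 0 < n → fromℕ n ≢ 0ℚ
fromℕ≢0 0<n eq = ℕ.<⇒≢ 0<n (sym (fromℕ-injective eq))

coeff-X*ₚ-zero : ∀ p → coeff (X *ₚ p) 0 ≡ 0ℚ
coeff-X*ₚ-zero p = trans (coeff-*ₚ-zero 0ℚ (1ℚ ∷ []) p) (ℚ.*-zeroˡ (coeff p 0))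

coeff-X*ₚ-suc : ∀ p i → coeff (X *ₚ p) (suc i) ≡ coeff p i
coeff-X*ₚ-suc p i = begin
  coeff (X *ₚ p) (suc i)                              ≡⟨ coeff-*ₚ-suc 0ℚ (1ℚ ∷ []) p i ⟩
  0ℚ ℚ.* coeff p (suc i) ℚ.+ coeff ((1ℚ ∷ []) *ₚ p) i ≡⟨ cong (ℚ._+ coeff ((1ℚ ∷ []) *ₚ p) i)
                                                             (ℚ.*-zeroˡ (coeff p (suc i))) ⟩
  0ℚ ℚ.+ coeff ((1ℚ ∷ []) *ₚ p) i                     ≡⟨ ℚ.+-identityˡ _ ⟩
  coeff ((1ℚ ∷ []) *ₚ p) i                            ≡⟨ *ₚ-identityˡ p i ⟩
  coeff p i                                           ∎
  where open ≡-Reasoning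

coeff-X*ₚ : ∀ {p a} → (∀ j → coeff p j ≡ fromℕ (a j)) → ∀ j → coeff (X *ₚ p) j ≡ fromℕ (X* a j)
coeff-X*ₚ {p} p≡a zero    = coeff-X*ₚ-zero p
coeff-X*ₚ {p} p≡a (suc j) = trans (coeff-X*ₚ-suc p j) (p≡a j)

coeff-Luc : ∀ n j → coeff (Luc n) j ≡ fromℕ (lucasCoeff n j)
coeff-Luc zero          zero    = refl
coeff-Luc zero          (suc j) = refl
coeff-Luc (suc zero)    zero    = refl
coeff-Luc (suc zero)    (suc j) = refl
coeff-Luc (suc (suc n)) j       = begin
  coeff (Luc (suc n) +ₚ (X *ₚ Luc n)) j
    ≡⟨ coeff-+ₚ (Luc (suc n)) (X *ₚ Luc n) j ⟩
  coeff (Luc (suc n)) j ℚ.+ coeff (X *ₚ Luc n) j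
    ≡⟨ cong₂ ℚ._+_ (coeff-Luc (suc n) j) (coeff-X*ₚ {Luc n} (coeff-Luc n) j) ⟩
  fromℕ (lucasCoeff (suc n) j) ℚ.+ fromℕ (X* (lucasCoeff n) j)
    ≡⟨ fromℕ-+ (lucasCoeff (suc n) j) (X* (lucasCoeff n) j) ⟩
  fromℕ (lucasCoeff (suc (suc n)) j) ∎
  where open ≡-Reasoning

Luc-coeff-zero≢0 : ∀ n → coeff (Luc n) 0 ≢ 0ℚ
Luc-coeff-zero≢0 n eq = fromℕ≢0 (lucasCoeff-zero-pos n) (trans (sym (coeff-Luc n 0)) eq)

VanishesAbove : ℕ → Poly → Set
VanishesAbove d p = ∀ i → d < i → coeff p i ≡ 0ℚ

vanishesAbove-mono : ∀ {d d′ p} → d ≤ d′ → VanishesAbove d p → VanishesAbove d′ p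
vanishesAbove-mono d≤d′ p-vanishes i d′<i = p-vanishes i (ℕ.≤-<-trans d≤d′ d′<i)

coeff-≥length : ∀ p i → length p ≤ i → coeff p i ≡ 0ℚ
coeff-≥length []      i       _         = refl
coeff-≥length (a ∷ p) (suc i) (s≤s len≤i) = coeff-≥length p i len≤i

Luc-vanishesAbove : ∀ n → VanishesAbove ⌊ n /2⌋ (Luc n)
Luc-vanishesAbove n i ⌊n/2⌋<i = trans (coeff-Luc n i) (cong fromℕ (lucasCoeff-vanish n i ⌊n/2⌋<i))

coeff-*ₚ-top : ∀ p q d t → VanishesAbove d p → VanishesAbove t q →
  coeff (p *ₚ q) (d + t) ≡ coeff p d ℚ.* coeff q t
coeff-*ₚ-top []      q d t p-vanishes q-vanishes = sym (ℚ.*-zeroˡ (coeff q t))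
coeff-*ₚ-top (a ∷ p) q zero zero p-vanishes q-vanishes = coeff-*ₚ-zero a p q
coeff-*ₚ-top (a ∷ p) q zero (suc t) p-vanishes q-vanishes = begin
  coeff ((a ∷ p) *ₚ q) (suc t)
    ≡⟨ coeff-*ₚ-suc a p q t ⟩
  a ℚ.* coeff q (suc t) ℚ.+ coeff (p *ₚ q) t
    ≡⟨ cong (a ℚ.* coeff q (suc t) ℚ.+_) (*ₚ-zeroˡ p q (λ i → p-vanishes (suc i) (s≤s z≤n)) t) ⟩
  a ℚ.* coeff q (suc t) ℚ.+ 0ℚ
    ≡⟨ ℚ.+-identityʳ _ ⟩
  a ℚ.* coeff q (suc t) ∎
  where open ≡-Reasoning
coeff-*ₚ-top (a ∷ p) q (suc d) t p-vanishes q-vanishes = begin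
  coeff ((a ∷ p) *ₚ q) (suc (d + t))
    ≡⟨ coeff-*ₚ-suc a p q (d + t) ⟩
  a ℚ.* coeff q (suc (d + t)) ℚ.+ coeff (p *ₚ q) (d + t)
    ≡⟨ cong₂ ℚ._+_ (cong (a ℚ.*_) (q-vanishes (suc (d + t)) (s≤s (ℕ.m≤n+m t d))))
                   (coeff-*ₚ-top p q d t (λ i d<i → p-vanishes (suc i) (s≤s d<i)) q-vanishes) ⟩
  a ℚ.* 0ℚ ℚ.+ coeff p d ℚ.* coeff q t
    ≡⟨ cong (ℚ._+ coeff p d ℚ.* coeff q t) (ℚ.*-zeroʳ a) ⟩
  0ℚ ℚ.+ coeff p d ℚ.* coeff q t
    ≡⟨ ℚ.+-identityˡ _ ⟩
  coeff p d ℚ.* coeff q t ∎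
  where open ≡-Reasoning

quotient-constant : ∀ {p q d} → coeff p d ≢ 0ℚ → VanishesAbove d p →
  VanishesAbove d (q *ₚ p) → VanishesAbove 0 q
quotient-constant {p} {q} {d} p_d≢0 p-vanishes qp-vanishes t 0<t =
  from-top (length q) t 0<t (ℕ.m≤n+m (length q) t)
  where
  from-top : ∀ u t → 0 < t → length q ≤ t + u → coeff q t ≡ 0ℚ
  from-top zero    t _   len≤t   = coeff-≥length q t (subst (length q ≤_) (ℕ.+-identityʳ t) len≤t)
  from-top (suc u) t 0<t len≤t+u = p≢0∧p*q≡0⇒q≡0 p_d≢0 (begin
    coeff p d ℚ.* coeff q t  ≡⟨ sym (coeff-*ₚ-top p q d t p-vanishes q-vanishes) ⟩
    coeff (p *ₚ q) (d + t)   ≡⟨ *ₚ-comm p q (d + t) ⟩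
    coeff (q *ₚ p) (d + t)   ≡⟨ qp-vanishes (d + t) (ℕ.m<m+n d 0<t) ⟩
    0ℚ                       ∎)
    where
    open ≡-Reasoning
    q-vanishes : VanishesAbove t q
    q-vanishes s t<s = from-top u s (ℕ.<-trans 0<t t<s)
      (ℕ.≤-trans len≤t+u (ℕ.≤-trans (ℕ.≤-reflexive (ℕ.+-suc t u)) (ℕ.+-monoˡ-≤ u t<s)))

coeff-*ₚ-constant : ∀ {q} p → VanishesAbove 0 q → ∀ i → coeff (q *ₚ p) i ≡ coeff q 0 ℚ.* coeff p i
coeff-*ₚ-constant {q} p q-constant i =
  trans (*ₚ-congˡ {q} {coeff q 0 ∷ []} p q≈c i) (coeff-const*ₚ i)
  where
  q≈c : q ≈ₚ (coeff q 0 ∷ [])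
  q≈c zero    = refl
  q≈c (suc i) = q-constant (suc i) (s≤s z≤n)
  coeff-const*ₚ : ∀ i → coeff ((coeff q 0 ∷ []) *ₚ p) i ≡ coeff q 0 ℚ.* coeff p i
  coeff-const*ₚ zero    = coeff-*ₚ-zero (coeff q 0) [] p
  coeff-const*ₚ (suc i) = trans (coeff-*ₚ-suc (coeff q 0) [] p i) (ℚ.+-identityʳ _)

-- Divisibility among Lucas polynomials

open RingDivisibility ℚ[x]
open import Algebra.Properties.Semiring.Divisibility ℚ[x].semiring
  using (_∣_; _,_; ∣ʳ-refl; ∣ʳ-respʳ-≈; x∣ʳyx; x∣ʳy⇒x∣ʳzy)
open import Algebra.Properties.CommutativeMagma.Divisibility ℚ[x].*-commutativeMagma
  using (x∣xy)

coeff-*ₚ-zero′ : ∀ p q → coeff (p *ₚ q) 0 ≡ coeff p 0 ℚ.* coeff q 0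
coeff-*ₚ-zero′ []      q = sym (ℚ.*-zeroˡ (coeff q 0))
coeff-*ₚ-zero′ (a ∷ p) q = coeff-*ₚ-zero a p q

X*ₚ-drop₁ : ∀ q → coeff q 0 ≡ 0ℚ → q ≃ X *ₚ drop 1 q
X*ₚ-drop₁ q q₀≡0 = mk≃ λ
  { zero    → trans q₀≡0 (sym (coeff-X*ₚ-zero (drop 1 q)))
  ; (suc i) → trans (coeff-drop₁ q i) (sym (coeff-X*ₚ-suc (drop 1 q) i)) }
  where
  coeff-drop₁ : ∀ q i → coeff q (suc i) ≡ coeff (drop 1 q) i
  coeff-drop₁ []      i = refl
  coeff-drop₁ (a ∷ q) i = refl

X*ₚ-injective : ∀ {p q} → X *ₚ p ≃ X *ₚ q → p ≃ q
X*ₚ-injective {p} {q} (mk≃ Xp≈Xq) =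
  mk≃ λ i → trans (sym (coeff-X*ₚ-suc p i)) (trans (Xp≈Xq (suc i)) (coeff-X*ₚ-suc q i))

∣-X*ₚ-cancel : ∀ {d p} → coeff d 0 ≢ 0ℚ → d ∣ X *ₚ p → d ∣ p
∣-X*ₚ-cancel {d} {p} d₀≢0 (q , q*d≃Xp) = drop 1 q , X*ₚ-injective (begin
  X *ₚ (drop 1 q *ₚ d)  ≈⟨ ℚ[x].sym (ℚ[x].*-assoc X (drop 1 q) d) ⟩
  (X *ₚ drop 1 q) *ₚ d  ≈⟨ ℚ[x].*-congʳ {d} (ℚ[x].sym (X*ₚ-drop₁ q q₀≡0)) ⟩
  q *ₚ d                ≈⟨ q*d≃Xp ⟩
  X *ₚ p                ∎)
  where
  open ≃-Reasoning
  q₀≡0 : coeff q 0 ≡ 0ℚ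
  q₀≡0 = p≢0∧p*q≡0⇒q≡0 d₀≢0 (trans (ℚ.*-comm (coeff d 0) (coeff q 0))
           (trans (sym (coeff-*ₚ-zero′ q d)) (trans (coeff-≡ q*d≃Xp 0) (coeff-X*ₚ-zero p))))

∣-negX^*ₚ-cancel : ∀ {d p} → coeff d 0 ≢ 0ℚ → ∀ k → d ∣ negX^ k *ₚ p → d ∣ p
∣-negX^*ₚ-cancel {p = p} d₀≢0 zero    d∣1p    = ∣ʳ-respʳ-≈ (ℚ[x].*-identityˡ p) d∣1p
∣-negX^*ₚ-cancel {p = p} d₀≢0 (suc k) d∣-XNp =
  ∣-negX^*ₚ-cancel d₀≢0 k (∣ʳ-respʳ-≈ (neg-involutive (negX^ k *ₚ p))
    (∣-neg (∣-X*ₚ-cancel d₀≢0 (∣ʳ-respʳ-≈ (negXN*p≃X*negNp X (negX^ k) p) d∣-XNp))))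
  where
  negXN*p≃X*negNp : ∀ x n p → ((ℚ[x].- x) *ₚ n) *ₚ p ≃ x *ₚ (ℚ[x].- (n *ₚ p))
  negXN*p≃X*negNp = solve 3 (λ x n p → ((:- x) :* n) :* p := x :* (:- (n :* p))) ℚ[x].refl
  neg-involutive : ∀ a → ℚ[x].- (ℚ[x].- a) ≃ a
  neg-involutive = solve 1 (λ a → :- (:- a) := a) ℚ[x].refl

Luc-∤-smaller : ∀ {k r} → 2 ≤ k → r < k → ¬ (Luc k ∣ Luc r)
Luc-∤-smaller {k@(suc (suc k′))} {r} (s≤s (s≤s z≤n)) r<k (q , mk≃ q*Lₖ≈Lᵣ) =
  ℕ.<-irrefl refl (begin-strict
  lucasCoeff r 1      ≤⟨ lucasCoeff-one-≤ r ⟩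
  r                   <⟨ r<k ⟩
  k                   ≤⟨ ℕ.m≤n*m k (lucasCoeff r 0) ⟩
  lucasCoeff r 0 * k  ≡⟨ sym (fromℕ-injective coeff₁) ⟩
  lucasCoeff r 1      ∎)
  where
  open ℕ.≤-Reasoning
  instance _ = ℕ.>-nonZero (lucasCoeff-zero-pos r)
  q-constant : VanishesAbove 0 q
  q-constant = quotient-constant {Luc k} {q} {⌊ k /2⌋}
    (λ eq → fromℕ≢0 (lucasCoeff-top-pos k) (trans (sym (coeff-Luc k ⌊ k /2⌋)) eq))
    (Luc-vanishesAbove k)
    (λ i k/2<i → trans (q*Lₖ≈Lᵣ i)
       (vanishesAbove-mono {p = Luc r} (ℕ.⌊n/2⌋-mono (ℕ.<⇒≤ r<k)) (Luc-vanishesAbove r) i k/2<i))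
  c = coeff q 0
  Lᵣ≡c*Lₖ : ∀ i → fromℕ (lucasCoeff r i) ≡ c ℚ.* fromℕ (lucasCoeff k i)
  Lᵣ≡c*Lₖ i = trans (sym (coeff-Luc r i))
    (trans (sym (q*Lₖ≈Lᵣ i))
      (trans (coeff-*ₚ-constant {q} (Luc k) q-constant i) (cong (c ℚ.*_) (coeff-Luc k i))))
  c≡Lᵣ₀ : c ≡ fromℕ (lucasCoeff r 0)
  c≡Lᵣ₀ = sym (trans (Lᵣ≡c*Lₖ 0) (trans (cong (λ n → c ℚ.* fromℕ n) (lucasCoeff-suc-zero (suc k′)))
                                         (ℚ.*-identityʳ c)))
  coeff₁ : fromℕ (lucasCoeff r 1) ≡ fromℕ (lucasCoeff r 0 * k)
  coeff₁ = trans (Lᵣ≡c*Lₖ 1) (trans (cong₂ (λ a n → a ℚ.* fromℕ n) c≡Lᵣ₀ (lucasCoeff-one k′))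
                                    (fromℕ-* (lucasCoeff r 0) k))

Luc-∣-expand : ∀ {d} b m → d ∣ Luc b *ₚ Luc (b + m) → d ∣ Luc m → d ∣ Luc (b + b + m)
Luc-∣-expand b m d∣LL d∣L =
  ∣-cancelʳ-+ (∣ʳ-respʳ-≈ (ℚ[x].sym (Luc-identity b m)) d∣LL) (x∣ʳy⇒x∣ʳzy (negX^ b) d∣L)

Luc-∣-contract : ∀ {d} b m → coeff d 0 ≢ 0ℚ →
  d ∣ Luc b *ₚ Luc (b + m) → d ∣ Luc (b + b + m) → d ∣ Luc m
Luc-∣-contract b m d₀≢0 d∣LL d∣L =
  ∣-negX^*ₚ-cancel d₀≢0 b (∣-cancelˡ-+ (∣ʳ-respʳ-≈ (ℚ[x].sym (Luc-identity b m)) d∣LL) d∣L)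

Luc-∣-odd-multiple : ∀ k m → Luc k ∣ Luc (m * (k + k) + k)
Luc-∣-odd-multiple k zero    = ∣ʳ-refl
Luc-∣-odd-multiple k (suc m) = subst (λ i → Luc k ∣ Luc i) (sym (ℕ.+-assoc (k + k) (m * (k + k)) k))
  (Luc-∣-expand k (m * (k + k) + k) (x∣xy (Luc k) _) (Luc-∣-odd-multiple k m))

Luc-∣-reduce : ∀ k j r → Luc k ∣ Luc (j * (k + k) + r) → Luc k ∣ Luc r
Luc-∣-reduce k zero    r Lₖ∣L = Lₖ∣L
Luc-∣-reduce k (suc j) r Lₖ∣L = Luc-∣-reduce k j r
  (Luc-∣-contract k (j * (k + k) + r) (Luc-coeff-zero≢0 k) (x∣xy (Luc k) _)
    (subst (λ i → Luc k ∣ Luc i) (ℕ.+-assoc (k + k) (j * (k + k)) r) Lₖ∣L))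

Luc-∣-below-double : ∀ {k r} → 2 ≤ k → r < k + k → Luc k ∣ Luc r → r ≡ k
Luc-∣-below-double {k} {r} 2≤k r<2k Lₖ∣Lᵣ with r ℕ.<? k
... | yes r<k = ⊥-elim (Luc-∤-smaller 2≤k r<k Lₖ∣Lᵣ)
... | no  r≮k with ℕ.m≤n⇒∃[o]m+o≡n (ℕ.≮⇒≥ r≮k)
...   | zero   , k+0≡r = trans (sym k+0≡r) (ℕ.+-identityʳ k)
...   | suc b′ , k+b≡r = ⊥-elim (Luc-∤-smaller 2≤k c<k Lₖ∣Lc)
  where
  b = suc b′
  b<k : b < k
  b<k = ℕ.+-cancelˡ-< k b k (subst (_< k + k) (sym k+b≡r) r<2k)
  c = proj₁ (ℕ.m≤n⇒∃[o]m+o≡n (ℕ.<⇒≤ b<k))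
  b+c≡k : b + c ≡ k
  b+c≡k = proj₂ (ℕ.m≤n⇒∃[o]m+o≡n (ℕ.<⇒≤ b<k))
  c<k : c < k
  c<k = subst (c <_) b+c≡k (ℕ.m<n+m c (s≤s z≤n))
  b+b+c≡r : b + b + c ≡ r
  b+b+c≡r = trans (ℕ.+-assoc b b c) (trans (cong (b +_) b+c≡k) (trans (ℕ.+-comm b k) k+b≡r))
  -- Luc-identity for (b, c) reads Luc b · Luc k ≃ Luc r + (-x)^b · Luc c.
  Lₖ∣Lc : Luc k ∣ Luc c
  Lₖ∣Lc = Luc-∣-contract b c (Luc-coeff-zero≢0 k)
    (subst (λ i → Luc k ∣ Luc b *ₚ Luc i) (sym b+c≡k) (x∣ʳyx (Luc k) (Luc b)))
    (subst (λ i → Luc k ∣ Luc i) (sym b+b+c≡r) Lₖ∣Lᵣ)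

odd-multiple-≡ : ∀ k m → m * (k + k) + k ≡ k * (2 * m + 1)
odd-multiple-≡ = solve-∀

Luc-∣⇔odd-multiple : ∀ {k n} → 2 ≤ k → Luc k ∣ Luc n ⇔ ∃ λ m → n ≡ k * (2 * m + 1)
Luc-∣⇔odd-multiple {k@(suc (suc _))} {n} 2≤k@(s≤s (s≤s z≤n)) = mk⇔ to from
  where
  to : Luc k ∣ Luc n → ∃ λ m → n ≡ k * (2 * m + 1)
  to Lₖ∣Lₙ = j , trans n≡j*2k+r (trans (cong (j * (k + k) +_) r≡k) (odd-multiple-≡ k j))
    where
    j = n / (k + k)
    r = n % (k + k)
    n≡j*2k+r : n ≡ j * (k + k) + r
    n≡j*2k+r = trans (m≡m%n+[m/n]*n n (k + k)) (ℕ.+-comm r (j * (k + k)))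
    r≡k : r ≡ k
    r≡k = Luc-∣-below-double 2≤k (m%n<n n (k + k))
      (Luc-∣-reduce k j r (subst (λ i → Luc k ∣ Luc i) n≡j*2k+r Lₖ∣Lₙ))
  from : (∃ λ m → n ≡ k * (2 * m + 1)) → Luc k ∣ Luc n
  from (m , n≡) =
    subst (λ i → Luc k ∣ Luc i) (trans (odd-multiple-≡ k m) (sym n≡)) (Luc-∣-odd-multiple k m)

-- Independent sets of cycles

lookupℕ : ∀ {n} → Vec Bool n → ℕ → Bool
lookupℕ []      i       = false
lookupℕ (b ∷ v) zero    = b
lookupℕ (b ∷ v) (suc i) = lookupℕ v i

lookup≡lookupℕ : ∀ {n} (S : Vec Bool n) i → lookup S i ≡ lookupℕ S (toℕ i)
lookup≡lookupℕ (b ∷ S) Fin.zero    = refl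
lookup≡lookupℕ (b ∷ S) (Fin.suc i) = lookup≡lookupℕ S i

T-allᵇ : ∀ {A : Set} (p : A → Bool) xs → T (allᵇ p xs) ⇔ (∀ {x} → x ∈ xs → T (p x))
T-allᵇ p []       = mk⇔ (λ _ ()) (λ _ → tt)
T-allᵇ p (x ∷ xs) = mk⇔
  (λ h → λ { (here refl) → proj₁ (Equivalence.to T-∧ h)
           ; (there x∈)  → Equivalence.to (T-allᵇ p xs) (proj₂ (Equivalence.to T-∧ h)) x∈ })
  (λ h → Equivalence.from T-∧ (h (here refl) , Equivalence.from (T-allᵇ p xs) (λ x∈ → h (there x∈))))

∧≡false⇔ : ∀ {a b} → (a ∧ b) ≡ false ⇔ (T a → b ≡ false)
∧≡false⇔ {false} = mk⇔ (λ _ ()) (λ _ → refl)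
∧≡false⇔ {true}  = mk⇔ (λ b≡false _ → b≡false) (λ f → f tt)

Independent : ∀ {n} → Graph n → Subset n → Set
Independent G S = ∀ i j → T (adj G i j) → (lookup S i ∧ lookup S j) ≡ false

isIndependent⇔ : ∀ {n} (G : Graph n) S → T (isIndependent G S) ⇔ Independent G S
isIndependent⇔ {n} G S = mk⇔
  (λ h i j → Equivalence.to (∧≡false⇔ ⇔-∘ T-not-≡)
               (Equivalence.to (T-allᵇ _ (allFin n))
                  (Equivalence.to (T-allᵇ _ (allFin n)) h (∈-allFin i)) (∈-allFin j)))
  (λ h → Equivalence.from (T-allᵇ _ (allFin n)) λ {i} _ →
           Equivalence.from (T-allᵇ _ (allFin n)) λ {j} _ →
             Equivalence.from (∧≡false⇔ ⇔-∘ T-not-≡) (h i j))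

cycleAdj⇔ : ∀ {m} (i j : Fin (suc m)) → T (cycleAdj (suc m) i j) ⇔
  (toℕ j ≡ suc (toℕ i) % suc m ⊎ toℕ i ≡ suc (toℕ j) % suc m)
cycleAdj⇔ {m} i j = mk⇔
  (λ adj → Sum.map (λ e → trans (ℕ.≡ᵇ⇒≡ _ _ e) (+1%≡ (toℕ i)))
                        (λ e → trans (ℕ.≡ᵇ⇒≡ _ _ e) (+1%≡ (toℕ j)))
                        (Equivalence.to T-∨ adj))
  (λ adj → Equivalence.from T-∨
    (Sum.map (λ e → ℕ.≡⇒≡ᵇ _ _ (trans e (sym (+1%≡ (toℕ i)))))
                  (λ e → ℕ.≡⇒≡ᵇ _ _ (trans e (sym (+1%≡ (toℕ j)))))
                  adj))
  where
  +1%≡ : ∀ a → (a + 1) % suc m ≡ suc a % suc m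
  +1%≡ a = cong (_% suc m) (ℕ.+-comm a 1)

CycleIndependent : ∀ {m} → Subset (suc m) → Set
CycleIndependent {m} S = ∀ i → i < suc m → (lookupℕ S i ∧ lookupℕ S (suc i % suc m)) ≡ false

Independent-cycle⇔ : ∀ {m} (S : Subset (suc m)) → Independent (C (suc m)) S ⇔ CycleIndependent S
Independent-cycle⇔ {m} S = mk⇔ to from
  where
  lookup-pair : ∀ i j → (lookup S i ∧ lookup S j) ≡ (lookupℕ S (toℕ i) ∧ lookupℕ S (toℕ j))
  lookup-pair i j = cong₂ _∧_ (lookup≡lookupℕ S i) (lookup≡lookupℕ S j)
  to : Independent (C (suc m)) S → CycleIndependent S
  to ind i i<n = subst₂ (λ a b → (lookupℕ S a ∧ lookupℕ S b) ≡ false)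
    (Fin.toℕ-fromℕ< i<n) (Fin.toℕ-fromℕ< (m%n<n (suc i) (suc m)))
    (trans (sym (lookup-pair fi fj)) (ind fi fj (Equivalence.from (cycleAdj⇔ fi fj) (inj₁ next))))
    where
    fi = fromℕ< i<n
    fj = fromℕ< (m%n<n (suc i) (suc m))
    next : toℕ fj ≡ suc (toℕ fi) % suc m
    next = trans (Fin.toℕ-fromℕ< (m%n<n (suc i) (suc m)))
                 (cong (λ a → suc a % suc m) (sym (Fin.toℕ-fromℕ< i<n)))
  from : CycleIndependent S → Independent (C (suc m)) S
  from cyc i j adj with Equivalence.to (cycleAdj⇔ i j) adj
  ... | inj₁ j≡i+1 = trans (lookup-pair i j)
    (subst (λ b → (lookupℕ S (toℕ i) ∧ lookupℕ S b) ≡ false) (sym j≡i+1) (cyc (toℕ i) (Fin.toℕ<n i)))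
  ... | inj₂ i≡j+1 = trans (lookup-pair i j) (trans (∧-comm (lookupℕ S (toℕ i)) _)
    (subst (λ a → (lookupℕ S (toℕ j) ∧ lookupℕ S a) ≡ false) (sym i≡j+1) (cyc (toℕ j) (Fin.toℕ<n j))))

-- independentPath l r v: the sequence l, v₀, …, vₘ₋₁, r has no two consecutive trues.
independentPath : ∀ {m} → Bool → Bool → Vec Bool m → Bool
independentPath l r []      = not (l ∧ r)
independentPath l r (b ∷ v) = not (l ∧ b) ∧ independentPath b r v

independentPath⇔ : ∀ {m} l r (v : Vec Bool m) → T (independentPath l r v) ⇔
  ((∀ i → i < m → (lookupℕ (l ∷ v) i ∧ lookupℕ (l ∷ v) (suc i)) ≡ false)
   × (lookupℕ (l ∷ v) m ∧ r) ≡ false)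
independentPath⇔ l r [] =
  mk⇔ (λ h → (λ i ()) , Equivalence.to T-not-≡ h)
      (λ (_ , l∧r≡false) → Equivalence.from T-not-≡ l∧r≡false)
independentPath⇔ l r (b ∷ v) = mk⇔
  (λ h → let (l∧b , rest) = Equivalence.to T-∧ h
             (pairs , last) = Equivalence.to (independentPath⇔ b r v) rest
         in (λ { zero _ → Equivalence.to T-not-≡ l∧b ; (suc i) (s≤s i<m) → pairs i i<m }) , last)
  (λ (pairs , last) → Equivalence.from T-∧
    ( Equivalence.from T-not-≡ (pairs 0 (s≤s z≤n))
    , Equivalence.from (independentPath⇔ b r v) ((λ i i<m → pairs (suc i) (s≤s i<m)) , last)))

CycleIndependent⇔independentPath : ∀ {m} b (v : Vec Bool m) →
  CycleIndependent (b ∷ v) ⇔ T (independentPath b b v)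
CycleIndependent⇔independentPath {m} b v = ⇔-sym (independentPath⇔ b b v) ⇔-∘ mk⇔ to from
  where
  S = b ∷ v
  wrap : lookupℕ S (suc m % suc m) ≡ b
  wrap = cong (lookupℕ S) (n%n≡0 (suc m))
  inner : ∀ {i} → i < m → suc i % suc m ≡ suc i
  inner i<m = m<n⇒m%n≡m (s≤s i<m)
  to : CycleIndependent S → _
  to cyc = (λ i i<m → subst (λ a → (lookupℕ S i ∧ lookupℕ S a) ≡ false) (inner i<m)
                              (cyc i (ℕ.m≤n⇒m≤1+n i<m)))
         , subst (λ a → (lookupℕ S m ∧ a) ≡ false) wrap (cyc m ℕ.≤-refl)
  from : _ → CycleIndependent S
  from (pairs , last) i i<1+m with ℕ.m≤n⇒m<n∨m≡n (ℕ.≤-pred i<1+m)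
  ... | inj₁ i<m  = subst (λ a → (lookupℕ S i ∧ lookupℕ S a) ≡ false) (sym (inner i<m)) (pairs i i<m)
  ... | inj₂ refl = subst (λ a → (lookupℕ S m ∧ a) ≡ false) (sym wrap) last

isIndependent-cycle : ∀ {m} b (v : Vec Bool m) →
  isIndependent (C (suc m)) (b ∷ v) ≡ independentPath b b v
isIndependent-cycle b v = ⇔→≡ {z = true}
  (T-≡ ⇔-∘ (CycleIndependent⇔independentPath b v ⇔-∘
     (Independent-cycle⇔ (b ∷ v) ⇔-∘ (isIndependent⇔ _ (b ∷ v) ⇔-∘ ⇔-sym T-≡))))

countᵇ-++ : ∀ {A : Set} (f : A → Bool) xs ys → countᵇ f (xs ++ ys) ≡ countᵇ f xs + countᵇ f ys
countᵇ-++ f []       ys = refl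
countᵇ-++ f (x ∷ xs) ys with f x
... | true  = cong suc (countᵇ-++ f xs ys)
... | false = countᵇ-++ f xs ys

countᵇ-map : ∀ {A B : Set} (f : B → Bool) (g : A → B) xs →
  countᵇ f (map g xs) ≡ countᵇ (λ x → f (g x)) xs
countᵇ-map f g []       = refl
countᵇ-map f g (x ∷ xs) with f (g x)
... | true  = cong suc (countᵇ-map f g xs)
... | false = countᵇ-map f g xs

countᵇ-cong : ∀ {A : Set} {f g : A → Bool} → (∀ x → f x ≡ g x) → ∀ xs → countᵇ f xs ≡ countᵇ g xs
countᵇ-cong {f = f} {g} f≡g []       = refl
countᵇ-cong {f = f} {g} f≡g (x ∷ xs) with f x | g x | f≡g x
... | true  | true  | _ = cong suc (countᵇ-cong f≡g xs)
... | false | false | _ = countᵇ-cong f≡g xs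

countᵇ-false : ∀ {A : Set} {f : A → Bool} → (∀ x → f x ≡ false) → ∀ xs → countᵇ f xs ≡ 0
countᵇ-false {f = f} f≡false []       = refl
countᵇ-false {f = f} f≡false (x ∷ xs) with f x | f≡false x
... | false | _ = countᵇ-false f≡false xs

countᵇ-allSubsets-suc : ∀ {m} (f : Subset (suc m) → Bool) → countᵇ f (allSubsets (suc m)) ≡
  countᵇ (λ w → f (true ∷ w)) (allSubsets m) + countᵇ (λ w → f (false ∷ w)) (allSubsets m)
countᵇ-allSubsets-suc {m} f =
  trans (countᵇ-++ f (map (true ∷_) (allSubsets m)) (map (false ∷_) (allSubsets m)))
        (cong₂ _+_ (countᵇ-map f (true ∷_) (allSubsets m)) (countᵇ-map f (false ∷_) (allSubsets m)))

countᵇ-size-suc : ∀ {m} (p : Subset m → Bool) j →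
  countᵇ (λ w → p w ∧ (suc ∣ w ∣ ≡ᵇ j)) (allSubsets m)
    ≡ X* (λ j → countᵇ (λ w → p w ∧ (∣ w ∣ ≡ᵇ j)) (allSubsets m)) j
countᵇ-size-suc {m} p zero    = countᵇ-false (λ w → ∧-zeroʳ (p w)) (allSubsets m)
countᵇ-size-suc     p (suc j) = refl

pathCount : Bool → Bool → ℕ → ℕ → ℕ
pathCount l r m j = countᵇ (λ v → independentPath l r v ∧ (∣ v ∣ ≡ᵇ j)) (allSubsets m)

pathCount-true : ∀ r m j → pathCount true r (suc m) j ≡ pathCount false r m j
pathCount-true r m j =
  trans (countᵇ-allSubsets-suc {m} (λ v → independentPath true r v ∧ (∣ v ∣ ≡ᵇ j)))
        (cong (_+ pathCount false r m j) (countᵇ-false (λ _ → refl) (allSubsets m)))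

pathCount-false : ∀ r m j →
  pathCount false r (suc m) j ≡ pathCount false r m j + X* (pathCount true r m) j
pathCount-false r m j =
  trans (countᵇ-allSubsets-suc {m} (λ v → independentPath false r v ∧ (∣ v ∣ ≡ᵇ j)))
        (trans (cong (_+ pathCount false r m j) (countᵇ-size-suc {m} (independentPath true r) j))
               (ℕ.+-comm (X* (pathCount true r m) j) (pathCount false r m j)))

pathCount-recurrent : ∀ r → RecurrentCoeffs (pathCount false r)
pathCount-recurrent r m j =
  trans (pathCount-false r (suc m) j)
        (cong (pathCount false r (suc m) j +_) (X*-cong (pathCount-true r m) j))

pathCount-right-true : ∀ m j → pathCount false true (suc m) j ≡ pathCount false false m j
pathCount-right-true =
  recurrentCoeffs-unique (λ m → pathCount-recurrent true (suc m)) (pathCount-recurrent false)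
  (λ { zero → refl ; (suc j) → refl })
  (λ { zero → refl ; (suc zero) → refl ; (suc (suc j)) → refl })

indepCount-cycle : ∀ t j →
  indepCount (C (3 + t)) j ≡ X* (pathCount false false t) j + pathCount false false (2 + t) j
indepCount-cycle t j = begin
  indepCount (C (3 + t)) j
    ≡⟨ countᵇ-allSubsets-suc {2 + t} (λ S → isIndependent (C (3 + t)) S ∧ (∣ S ∣ ≡ᵇ j)) ⟩
  countᵇ (λ w → isIndependent (C (3 + t)) (true ∷ w) ∧ (suc ∣ w ∣ ≡ᵇ j)) (allSubsets (2 + t))
    + countᵇ (λ w → isIndependent (C (3 + t)) (false ∷ w) ∧ (∣ w ∣ ≡ᵇ j)) (allSubsets (2 + t))
    ≡⟨ cong₂ _+_
         (countᵇ-cong (λ w → cong (_∧ (suc ∣ w ∣ ≡ᵇ j)) (isIndependent-cycle true w)) (allSubsets (2 + t)))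
         (countᵇ-cong (λ w → cong (_∧ (∣ w ∣ ≡ᵇ j)) (isIndependent-cycle false w)) (allSubsets (2 + t))) ⟩
  countᵇ (λ w → independentPath true true w ∧ (suc ∣ w ∣ ≡ᵇ j)) (allSubsets (2 + t))
    + pathCount false false (2 + t) j
    ≡⟨ cong (_+ pathCount false false (2 + t) j)
            (countᵇ-size-suc {2 + t} (independentPath true true) j) ⟩
  X* (pathCount true true (2 + t)) j + pathCount false false (2 + t) j
    ≡⟨ cong (_+ pathCount false false (2 + t) j)
            (X*-cong (λ i → trans (pathCount-true true (1 + t) i) (pathCount-right-true t i)) j) ⟩
  X* (pathCount false false t) j + pathCount false false (2 + t) j ∎
  where open ≡-Reasoning

lucasCoeff-cycle : ∀ t j →
  lucasCoeff (3 + t) j ≡ X* (pathCount false false t) j + pathCount false false (2 + t) j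
lucasCoeff-cycle = recurrentCoeffs-unique (λ t → lucasCoeff-recurrent (3 + t))
  (recurrentCoeffs-+ (recurrentCoeffs-X* (pathCount-recurrent false))
                     (λ t → pathCount-recurrent false (2 + t)))
  (λ { 0 → refl ; 1 → refl ; 2 → refl ; (suc (suc (suc j))) → refl })
  (λ { 0 → refl ; 1 → refl ; 2 → refl ; 3 → refl ; (suc (suc (suc (suc j)))) → refl })

indepCount-cycle≡lucasCoeff : ∀ {n} → 3 ≤ n → ∀ j → indepCount (C n) j ≡ lucasCoeff n j
indepCount-cycle≡lucasCoeff {suc (suc (suc t))} (s≤s (s≤s (s≤s z≤n))) j =
  trans (indepCount-cycle t j) (sym (lucasCoeff-cycle t j))

coeff-map-applyUpTo : ∀ (f : ℕ → ℚ) g {m j} → j < m → coeff (map f (applyUpTo g m)) j ≡ f (g j)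
coeff-map-applyUpTo f g {suc m} {zero}  _         = refl
coeff-map-applyUpTo f g {suc m} {suc j} (s≤s j<m) = coeff-map-applyUpTo f (λ i → g (suc i)) j<m

coeff-I : ∀ {n} (G : Graph n) {j} → j ≤ n → coeff (I G) j ≡ fromℕ (indepCount G j)
coeff-I G j≤n = coeff-map-applyUpTo (λ j → fromℕ (indepCount G j)) (λ i → i) (s≤s j≤n)

I-vanishesAbove : ∀ {n} (G : Graph n) → VanishesAbove n (I G)
I-vanishesAbove {n} G j n<j = coeff-≥length (I G) j (ℕ.≤-trans (ℕ.≤-reflexive length-I) n<j)
  where
  length-I : length (I G) ≡ suc n
  length-I = trans (length-map (λ j → fromℕ (indepCount G j)) (upTo (suc n)))
                   (length-applyUpTo (λ i → i) (suc n))

I-cycle≃Luc : ∀ {n} → 3 ≤ n → I (C n) ≃ Luc n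
I-cycle≃Luc {n} 3≤n = mk≃ I≈Luc
  where
  I≈Luc : I (C n) ≈ₚ Luc n
  I≈Luc j with j ℕ.≤? n
  ... | yes j≤n = trans (coeff-I (C n) j≤n)
    (trans (cong fromℕ (indepCount-cycle≡lucasCoeff 3≤n j)) (sym (coeff-Luc n j)))
  ... | no  j≰n = trans (I-vanishesAbove (C n) j n<j)
    (sym (Luc-vanishesAbove n j (ℕ.≤-<-trans (ℕ.⌊n/2⌋≤n n) n<j)))
    where n<j = ℕ.≰⇒> j≰n

∣ₚ⇔∣ : ∀ {d d′ p p′} → d ≃ d′ → p ≃ p′ → (d ∣ₚ p) ⇔ (d′ ∣ p′)
∣ₚ⇔∣ {d} {d′} {p} {p′} (mk≃ d≈d′) (mk≃ p≈p′) = mk⇔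
  (λ (q , p≈dq) → q , mk≃ λ i → trans (*ₚ-comm q d′ i)
     (trans (sym (*ₚ-congˡ {d} {d′} q d≈d′ i)) (trans (sym (p≈dq i)) (p≈p′ i))))
  (λ (q , mk≃ qd′≈p′) → q , λ i → trans (p≈p′ i)
     (trans (sym (qd′≈p′ i)) (trans (*ₚ-comm q d′ i) (sym (*ₚ-congˡ {d} {d′} q d≈d′ i)))))

corollary2 : (k n : ℕ) → 3 ≤ k → 3 ≤ n →
    (I (C k) ∣ₚ I (C n)) ⇔ ∃ (λ m → n ≡ k * (2 * m + 1))
corollary2 k n 3≤k 3≤n =
  Luc-∣⇔odd-multiple (ℕ.≤-trans (ℕ.n≤1+n 2) 3≤k) ⇔-∘ ∣ₚ⇔∣ (I-cycle≃Luc 3≤k) (I-cycle≃Luc 3≤n)
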